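{- Let $X$ be a finite set with $|X|\ge3$ and $\mathfrak{C}$ the set of partial choice functions on pairs from $X$. Let $\mathscr{C}\subseteq\mathfrak{C}$ be such that $c^{x,y,z}\in\operatorname{maj}^{\mathrm{cl}}(\mathscr{C})$ for every 3-element set $\{x,y,z\}\subseteq X$ (and every ordering of it). Then for every $k\ge3$ and every $k$ distinct elements $x_1,\dots,x_k$ of $X$, the cyclic function $c^{x_1,\dots,x_k}$ belongs to $\operatorname{maj}^{\mathrm{cl}}(\mathscr{C})$.
   Context: $\mathfrak{C}$ is the set of all functions $c\colon Y\to X$ with $Y\subseteq\binom{X}{2}$ and $c\{x,y\}\in\{x,y\}$. $W^x_y(c)$ is $1$ if $c\{x,y\}=x$, $-1$ if $c\{x,y\}=y$, $0$ if $\{x,y\}\notin\operatorname{dom}c$ (including $x=y$). For $\mathscr{C}\subseteq\mathfrak{C}$, $\operatorname{maj}^{\mathrm{cl}}(\mathscr{C})$ is the set of $d\in\mathfrak{C}$ for which there are rationals $r_c\in[0,1]$ ($c\in\mathscr{C}$) with $\sum_c r_c=1$ and $d\{x,y\}=x\iff\sum_c W^x_y(c)r_c>0$. For distinct $x_1,\dots,x_k$, the cyclic function $c^{x_1,\dots,x_k}$ is defined exactly on the pairs $\{x_i,x_{i+1}\}$ (indices mod $k$) with $c^{x_1,\dots,x_k}\{x_i,x_{i+1}\}=x_i$, and no other pair is in its domain; the triangular function $c^{x,y,z}$ is the case $k=3$. -}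

module Defs where

open import Data.Nat as ℕ using (ℕ; zero; suc)
open import Data.Nat.DivMod using (_%_; m%n<n)
open import Data.Fin as Fin using (Fin; toℕ; fromℕ<)
open import Data.Fin.Properties using (any?)
open import Data.Maybe using (Maybe; just; nothing)
open import Data.Product using (Σ; Σ-syntax; _×_; _,_; ∃; proj₁)
open import Data.Sum using (_⊎_)
open import Data.List using (List; []; _∷_)
open import Data.List.Relation.Unary.All using (All)
open import Data.Rational as ℚ using (ℚ; 0ℚ; 1ℚ; _≤_; _<_; _+_; _*_; -_)
open import Relation.Binary.PropositionalEquality using (_≡_; _≢_)
open import Relation.Nullary using (yes; no; Dec)
open import Relation.Nullary.Decidable using (_×-dec_)
open import Function.Bundles using (_⇔_)

-- A raw partial choice function on pairs from X = Fin n, written on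
-- ordered pairs: d x y = just z means {x,y} ∈ dom d and d{x,y} = z;
-- d x y = nothing means {x,y} ∉ dom d.
RawChoice : ℕ → Set
RawChoice n = Fin n → Fin n → Maybe (Fin n)

-- d is a genuine element of 𝔆: it is a function on a set Y of
-- 2-element subsets (symmetric, undefined on the diagonal) and chooses
-- an element of each pair.
record IsPCF {n : ℕ} (d : RawChoice n) : Set where
  field
    symm   : ∀ x y → d x y ≡ d y x
    irrefl : ∀ x → d x x ≡ nothing
    valid  : ∀ x y z → d x y ≡ just z → z ≡ x ⊎ z ≡ y

PCF : ℕ → Set
PCF n = Σ (RawChoice n) IsPCF

W : {n : ℕ} → Fin n → Fin n → PCF n → ℚ
W x y (c , _) with c x y
... | nothing = 0ℚ
... | just z with z Fin.≟ x
...   | yes _ = 1ℚ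
...   | no  _ = - 1ℚ

weightedW : {n : ℕ} → Fin n → Fin n → List (PCF n × ℚ) → ℚ
weightedW x y [] = 0ℚ
weightedW x y ((c , r) ∷ ws) = W x y c * r + weightedW x y ws

totalWeight : {n : ℕ} → List (PCF n × ℚ) → ℚ
totalWeight [] = 0ℚ
totalWeight ((_ , r) ∷ ws) = r + totalWeight ws

-- d ∈ maj^cl(𝒞), where 𝒞 ⊆ 𝔆 is given as a predicate on 𝔆.
-- The family (r_c) is given as a finite list of pairs (c , r_c) with
-- c ∈ 𝒞 (all other r_c are 0).
InMaj : {n : ℕ} → (PCF n → Set) → RawChoice n → Set
InMaj {n} 𝒞 d =
  IsPCF d ×
  Σ[ ws ∈ List (PCF n × ℚ) ]
    ( All (λ p → 𝒞 (Data.Product.proj₁ p) × (0ℚ ≤ Data.Product.proj₂ p) × (Data.Product.proj₂ p ≤ 1ℚ)) ws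
    × totalWeight ws ≡ 1ℚ
    × (∀ x y → (d x y ≡ just x) ⇔ (0ℚ < weightedW x y ws)) )

next : {k : ℕ} → Fin k → Fin k
next {suc m} i = fromℕ< (m%n<n (suc (toℕ i)) (suc m))

Step? : {n k : ℕ} (f : Fin k → Fin n) (x y : Fin n) →
        Dec (Σ[ i ∈ Fin k ] (f i ≡ x × f (next i) ≡ y))
Step? f x y = any? (λ i → (f i Fin.≟ x) ×-dec (f (next i) Fin.≟ y))

-- the cyclic function c^{x_1,…,x_k} with x_{i+1} = f i
cyc : {n k : ℕ} → (Fin k → Fin n) → RawChoice n
cyc f x y with Step? f x y
... | yes _ = just x
... | no _ with Step? f y x
...   | yes _ = just y
...   | no _  = nothing

-- Suppose the cycle
-- x₀ → … → x_m → x₀ is the majority relation of a convex combination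
-- ws₁ of elements of 𝒞, and the triangle x₀ → x_m → x_{m+1} → x₀ that
-- of ws₂.  The two relations orient the chord {x₀,x_m} oppositely and
-- agree everywhere else, so mixing ws₁ and ws₂ with weights chosen to
-- cancel the margins on {x₀,x_m} gives a convex combination whose
-- majority relation is the cycle x₀ → … → x_{m+1} → x₀.
module Submission where

open import Defs
open import Data.Nat using (ℕ; _≤_)
open import Data.Fin using (Fin)
open import Data.Vec using (_∷_; []; lookup)
open import Function.Definitions using (Injective)
open import Relation.Binary.PropositionalEquality using (_≡_; _≢_)

open import Data.Nat using (suc; _<_; s≤s; z≤n)
import Data.Nat.Properties as ℕP
open import Data.Nat.DivMod using (_%_; m%n<n; m<n⇒m%n≡m; n%n≡0)
open import Data.Fin as Fin using (toℕ; fromℕ<)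
import Data.Fin.Properties as FinP
open import Data.Rational
  using (ℚ; 0ℚ; 1ℚ; _+_; _*_; -_; 1/_; NonZero; positive; nonNegative; nonPositive)
  renaming (_≤_ to _≤ℚ_; _<_ to _<ℚ_)
import Data.Rational.Properties as ℚP
open import Data.Rational.Solver using (module +-*-Solver)
open import Data.Product using (Σ-syntax; _×_; _,_; proj₁; proj₂)
open import Data.Sum using (_⊎_; inj₁; inj₂)
open import Data.Empty using (⊥; ⊥-elim)
open import Data.Maybe using (just; nothing)
open import Data.Maybe.Properties using (just-injective)
open import Data.List using (List; []; _∷_; _++_)
open import Data.List.Relation.Unary.All using (All; []; _∷_)
open import Data.List.Relation.Unary.All.Properties using (++⁺)
open import Relation.Nullary using (¬_; Dec; yes; no)
open import Relation.Binary.PropositionalEquality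
  using (refl; sym; trans; cong; cong₂; subst; module ≡-Reasoning)
open import Function.Bundles using (_⇔_; mk⇔; Equivalence)
open import Function.Construct.Composition using (_⇔-∘_)
open import Function.Construct.Symmetry using (⇔-sym)

open Equivalence using (to; from)
open +-*-Solver using (solve; _:+_; _:*_; :-_; _:=_; con)

Rel : ℕ → Set₁
Rel n = Fin n → Fin n → Set

module _ {n : ℕ} where

  -- W is antisymmetric in its two points, because c is symmetric,
  -- undefined on the diagonal, and chooses one of the two points.
  W-antisym : ∀ (x y : Fin n) (c : PCF n) → W y x c ≡ - W x y c
  W-antisym x y (d , pcf) rewrite IsPCF.symm pcf y x with d x y in dxy
  ... | nothing = refl
  ... | just z with z Fin.≟ y | z Fin.≟ x | IsPCF.valid pcf x y z dxy
  ... | yes refl | yes refl | _ with () ← trans (sym dxy) (IsPCF.irrefl pcf z)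
  ... | yes _ | no _ | _ = refl
  ... | no _ | yes _ | _ = refl
  ... | no _ | no z≢x | inj₁ z≡x = ⊥-elim (z≢x z≡x)
  ... | no z≢y | no _ | inj₂ z≡y = ⊥-elim (z≢y z≡y)

  weightedW-antisym : ∀ (x y : Fin n) ws → weightedW y x ws ≡ - weightedW x y ws
  weightedW-antisym x y [] = refl
  weightedW-antisym x y ((c , r) ∷ ws)
    rewrite W-antisym x y c | weightedW-antisym x y ws =
    solve 3 (λ w r v → (:- w) :* r :+ (:- v) := :- (w :* r :+ v)) refl (W x y c) r (weightedW x y ws)

  scale : ℚ → List (PCF n × ℚ) → List (PCF n × ℚ)
  scale l [] = []
  scale l ((c , r) ∷ ws) = (c , l * r) ∷ scale l ws

  mix : ℚ → ℚ → List (PCF n × ℚ) → List (PCF n × ℚ) → List (PCF n × ℚ)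
  mix l m ws₁ ws₂ = scale l ws₁ ++ scale m ws₂

  weightedW-scale : ∀ (x y : Fin n) l ws → weightedW x y (scale l ws) ≡ l * weightedW x y ws
  weightedW-scale x y l [] = sym (ℚP.*-zeroʳ l)
  weightedW-scale x y l ((c , r) ∷ ws) rewrite weightedW-scale x y l ws =
    solve 4 (λ w l r v → w :* (l :* r) :+ l :* v := l :* (w :* r :+ v)) refl (W x y c) l r (weightedW x y ws)

  weightedW-++ : ∀ (x y : Fin n) ws vs → weightedW x y (ws ++ vs) ≡ weightedW x y ws + weightedW x y vs
  weightedW-++ x y [] vs = sym (ℚP.+-identityˡ _)
  weightedW-++ x y ((c , r) ∷ ws) vs rewrite weightedW-++ x y ws vs = sym (ℚP.+-assoc (W x y c * r) _ _)

  totalWeight-scale : ∀ l (ws : List (PCF n × ℚ)) → totalWeight (scale l ws) ≡ l * totalWeight ws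
  totalWeight-scale l [] = sym (ℚP.*-zeroʳ l)
  totalWeight-scale l ((c , r) ∷ ws) rewrite totalWeight-scale l ws = sym (ℚP.*-distribˡ-+ l r _)

  totalWeight-++ : ∀ (ws vs : List (PCF n × ℚ)) → totalWeight (ws ++ vs) ≡ totalWeight ws + totalWeight vs
  totalWeight-++ [] vs = sym (ℚP.+-identityˡ _)
  totalWeight-++ ((c , r) ∷ ws) vs rewrite totalWeight-++ ws vs = sym (ℚP.+-assoc r (totalWeight ws) _)

  weightedW-mix : ∀ (x y : Fin n) l m ws₁ ws₂ →
    weightedW x y (mix l m ws₁ ws₂) ≡ l * weightedW x y ws₁ + m * weightedW x y ws₂
  weightedW-mix x y l m ws₁ ws₂ =
    trans (weightedW-++ x y (scale l ws₁) (scale m ws₂))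
          (cong₂ _+_ (weightedW-scale x y l ws₁) (weightedW-scale x y m ws₂))

  totalWeight-mix : ∀ l m ws₁ ws₂ →
    totalWeight (mix l m ws₁ ws₂) ≡ l * totalWeight ws₁ + m * totalWeight ws₂
  totalWeight-mix l m ws₁ ws₂ =
    trans (totalWeight-++ (scale l ws₁) (scale m ws₂))
          (cong₂ _+_ (totalWeight-scale l ws₁) (totalWeight-scale m ws₂))

module _ {a b : ℚ} where

  pos*pos : 0ℚ <ℚ a → 0ℚ <ℚ b → 0ℚ <ℚ a * b
  pos*pos 0<a 0<b = ℚP.positive⁻¹ _ {{ℚP.pos*pos⇒pos a {{positive 0<a}} b {{positive 0<b}}}}

  nonNeg*nonNeg : 0ℚ ≤ℚ a → 0ℚ ≤ℚ b → 0ℚ ≤ℚ a * b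
  nonNeg*nonNeg 0≤a 0≤b = ℚP.nonNegative⁻¹ _ {{ℚP.nonNeg*nonNeg⇒nonNeg a {{nonNegative 0≤a}} b {{nonNegative 0≤b}}}}

  nonNeg*nonPos : 0ℚ ≤ℚ a → b ≤ℚ 0ℚ → a * b ≤ℚ 0ℚ
  nonNeg*nonPos 0≤a b≤0 = ℚP.nonPositive⁻¹ _ {{ℚP.nonNeg*nonPos⇒nonPos a {{nonNegative 0≤a}} b {{nonPositive b≤0}}}}

module _ {l m a b : ℚ} (0<l : 0ℚ <ℚ l) (0<m : 0ℚ <ℚ m) where

  mixture-pos : (0ℚ <ℚ a × 0ℚ ≤ℚ b) ⊎ (0ℚ ≤ℚ a × 0ℚ <ℚ b) → 0ℚ <ℚ l * a + m * b
  mixture-pos (inj₁ (0<a , 0≤b)) = ℚP.+-mono-<-≤ (pos*pos 0<l 0<a) (nonNeg*nonNeg (ℚP.<⇒≤ 0<m) 0≤b)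
  mixture-pos (inj₂ (0≤a , 0<b)) = ℚP.+-mono-≤-< (nonNeg*nonNeg (ℚP.<⇒≤ 0<l) 0≤a) (pos*pos 0<m 0<b)

  mixture-pos⁻¹ : 0ℚ <ℚ l * a + m * b → 0ℚ <ℚ a ⊎ 0ℚ <ℚ b
  mixture-pos⁻¹ 0<mix with 0ℚ ℚP.<? a | 0ℚ ℚP.<? b
  ... | yes 0<a | _ = inj₁ 0<a
  ... | no _ | yes 0<b = inj₂ 0<b
  ... | no a≯0 | no b≯0 = ⊥-elim (ℚP.<-irrefl refl (ℚP.<-≤-trans 0<mix mix≤0))
    where
      mix≤0 : l * a + m * b ≤ℚ 0ℚ
      mix≤0 = ℚP.+-mono-≤ (nonNeg*nonPos (ℚP.<⇒≤ 0<l) (ℚP.≮⇒≥ a≯0))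
                          (nonNeg*nonPos (ℚP.<⇒≤ 0<m) (ℚP.≮⇒≥ b≯0))

nonNeg-from-neg : ∀ {a} → ¬ (0ℚ <ℚ - a) → 0ℚ ≤ℚ a
nonNeg-from-neg -a≯0 = ℚP.≮⇒≥ (λ a<0 → -a≯0 (ℚP.neg-antimono-< a<0))

summand≤1 : ∀ {l m} → 0ℚ ≤ℚ m → l + m ≡ 1ℚ → l ≤ℚ 1ℚ
summand≤1 {l} {m} 0≤m l+m≡1 =
  subst (l ≤ℚ_) l+m≡1 (subst (_≤ℚ l + m) (ℚP.+-identityʳ l) (ℚP.+-monoʳ-≤ l 0≤m))

-- Given p, q > 0, the weights l = p/(p+q), m = q/(p+q) form a convex
-- pair with l·q = m·p.
record BalancingWeights (p q : ℚ) : Set where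
  field
    l m      : ℚ
    0<l      : 0ℚ <ℚ l
    0<m      : 0ℚ <ℚ m
    l+m≡1    : l + m ≡ 1ℚ
    balanced : l * q ≡ m * p

balancingWeights : ∀ {p q} → 0ℚ <ℚ p → 0ℚ <ℚ q → BalancingWeights p q
balancingWeights {p} {q} 0<p 0<q = record
  { l = p * i ; m = q * i ; 0<l = pos*pos 0<p 0<i ; 0<m = pos*pos 0<q 0<i
  ; l+m≡1 = trans (sym (ℚP.*-distribʳ-+ i p q)) (ℚP.*-inverseʳ s {{s≢0}})
  ; balanced = solve 3 (λ p q i → p :* i :* q := q :* i :* p) refl p q i }
  where
    s : ℚ
    s = p + q
    0<s : 0ℚ <ℚ s
    0<s = ℚP.+-mono-< 0<p 0<q
    s≢0 : NonZero s
    s≢0 = ℚP.pos⇒nonZero s {{positive 0<s}}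
    i : ℚ
    i = (1/ s) {{s≢0}}
    0<i : 0ℚ <ℚ i
    0<i = ℚP.positive⁻¹ i {{ℚP.1/pos⇒pos s {{positive 0<s}}}}

balanced-cancels : ∀ l m p q → l * q ≡ m * p → l * (- q) + m * p ≡ 0ℚ
balanced-cancels l m p q lq≡mp = begin
  l * (- q) + m * p   ≡⟨ cong (l * (- q) +_) (sym lq≡mp) ⟩
  l * (- q) + l * q   ≡⟨ solve 2 (λ l q → l :* (:- q) :+ l :* q := con 0ℚ) refl l q ⟩
  0ℚ                  ∎
  where open ≡-Reasoning

module _ {A : Set} where

  SamePair : A → A → A → A → Set
  SamePair a b x y = (a ≡ x × b ≡ y) ⊎ (a ≡ y × b ≡ x)

  samePair-swap : ∀ {a b x y} → SamePair a b x y → SamePair a b y x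
  samePair-swap (inj₁ (ax , by)) = inj₂ (ax , by)
  samePair-swap (inj₂ (ay , bx)) = inj₁ (ay , bx)

  Tri : A → A → A → A → A → Set
  Tri a b c x y = (a ≡ x × b ≡ y) ⊎ (b ≡ x × c ≡ y) ⊎ (c ≡ x × a ≡ y)

  Cancel : A → A → (A → A → Set) → (A → A → Set) → A → A → Set
  Cancel a b R₁ R₂ x y = (R₁ x y ⊎ R₂ x y) × ¬ SamePair a b x y

module _ {n : ℕ} (𝒞 : PCF n → Set) where

  Member : PCF n × ℚ → Set
  Member p = 𝒞 (proj₁ p) × 0ℚ ≤ℚ proj₂ p × proj₂ p ≤ℚ 1ℚ

  -- R is the strict majority relation of a convex combination of
  -- elements of 𝒞; InMaj 𝒞 d says exactly that d is a partial choice
  -- function whose decisions form such a relation.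
  MajRel : Rel n → Set
  MajRel R = Σ[ ws ∈ List (PCF n × ℚ) ]
    (All Member ws × totalWeight ws ≡ 1ℚ × (∀ x y → R x y ⇔ (0ℚ <ℚ weightedW x y ws)))

  majRel-transport : ∀ {R R′ : Rel n} → (∀ x y → R x y ⇔ R′ x y) → MajRel R → MajRel R′
  majRel-transport R⇔R′ (ws , members , total , maj) =
    ws , members , total , λ x y → mk⇔ (λ r′ → to (maj x y) (from (R⇔R′ x y) r′))
                                       (λ pos → to (R⇔R′ x y) (from (maj x y) pos))

  scale-members : ∀ {l} → 0ℚ ≤ℚ l → l ≤ℚ 1ℚ → ∀ {ws} → All Member ws → All Member (scale l ws)
  scale-members 0≤l l≤1 [] = []
  scale-members {l} 0≤l l≤1 {(c , r) ∷ _} ((c∈𝒞 , 0≤r , r≤1) ∷ members) =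
    ( c∈𝒞
    , nonNeg*nonNeg 0≤l 0≤r
    , ℚP.≤-trans (ℚP.*-monoˡ-≤-nonNeg l {{nonNegative 0≤l}} r≤1)
                 (subst (_≤ℚ 1ℚ) (sym (ℚP.*-identityʳ l)) l≤1) )
    ∷ scale-members 0≤l l≤1 members

  mix-convex : ∀ {l m ws₁ ws₂} → 0ℚ ≤ℚ l → 0ℚ ≤ℚ m → l + m ≡ 1ℚ →
    All Member ws₁ → totalWeight ws₁ ≡ 1ℚ → All Member ws₂ → totalWeight ws₂ ≡ 1ℚ →
    All Member (mix l m ws₁ ws₂) × totalWeight (mix l m ws₁ ws₂) ≡ 1ℚ
  mix-convex {l} {m} {ws₁} {ws₂} 0≤l 0≤m l+m≡1 members₁ total₁ members₂ total₂ =
    ++⁺ (scale-members 0≤l (summand≤1 0≤m l+m≡1) members₁)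
        (scale-members 0≤m (summand≤1 0≤l (trans (ℚP.+-comm m l) l+m≡1)) members₂) ,
    total
    where
      total : totalWeight (mix l m ws₁ ws₂) ≡ 1ℚ
      total = begin
        totalWeight (mix l m ws₁ ws₂)                ≡⟨ totalWeight-mix l m ws₁ ws₂ ⟩
        l * totalWeight ws₁ + m * totalWeight ws₂    ≡⟨ cong₂ (λ t₁ t₂ → l * t₁ + m * t₂) total₁ total₂ ⟩
        l * 1ℚ + m * 1ℚ                              ≡⟨ cong₂ _+_ (ℚP.*-identityʳ l) (ℚP.*-identityʳ m) ⟩
        l + m                                        ≡⟨ l+m≡1 ⟩
        1ℚ                                           ∎
        where open ≡-Reasoning

  majority-nonNeg : ∀ {R : Rel n} ws → (∀ x y → R x y ⇔ (0ℚ <ℚ weightedW x y ws)) →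
    ∀ {x y} → ¬ R y x → 0ℚ ≤ℚ weightedW x y ws
  majority-nonNeg ws maj {x} {y} ¬Ryx =
    nonNeg-from-neg (λ pos → ¬Ryx (from (maj y x) (subst (0ℚ <ℚ_) (sym (weightedW-antisym x y ws)) pos)))

  -- If R₁ and R₂ are majority relations over 𝒞
  -- orienting {a,b} oppositely and never oppositely orienting any other
  -- pair, then their union without {a,b} is a majority relation too:
  -- weigh the two families so that the margins on {a,b} cancel.
  cancel : ∀ {R₁ R₂ : Rel n} {a b} → MajRel R₁ → MajRel R₂ → R₁ b a → R₂ a b →
    (∀ x y → ¬ SamePair a b x y → R₁ x y → R₂ y x → ⊥) →
    MajRel (Cancel a b R₁ R₂)
  cancel {R₁} {R₂} {a} {b} (ws₁ , members₁ , total₁ , maj₁) (ws₂ , members₂ , total₂ , maj₂)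
         R₁ba R₂ab conflict-free =
    ws , proj₁ convex , proj₂ convex , λ x y → mk⇔ (forward x y) (backward x y)
    where
      open BalancingWeights (balancingWeights (to (maj₂ a b) R₂ab) (to (maj₁ b a) R₁ba))
      ws : List (PCF n × ℚ)
      ws = mix l m ws₁ ws₂
      convex : All Member ws × totalWeight ws ≡ 1ℚ
      convex = mix-convex (ℚP.<⇒≤ 0<l) (ℚP.<⇒≤ 0<m) l+m≡1 members₁ total₁ members₂ total₂

      neutral-ab : weightedW a b ws ≡ 0ℚ
      neutral-ab = begin
        weightedW a b ws                                  ≡⟨ weightedW-mix a b l m ws₁ ws₂ ⟩
        l * weightedW a b ws₁ + m * weightedW a b ws₂     ≡⟨ cong (λ t → l * t + m * weightedW a b ws₂)
                                                               (weightedW-antisym b a ws₁) ⟩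
        l * (- weightedW b a ws₁) + m * weightedW a b ws₂ ≡⟨ balanced-cancels l m _ _ balanced ⟩
        0ℚ                                                ∎
        where open ≡-Reasoning

      neutral : ∀ {x y} → SamePair a b x y → weightedW x y ws ≡ 0ℚ
      neutral (inj₁ (refl , refl)) = neutral-ab
      neutral (inj₂ (refl , refl)) = trans (weightedW-antisym a b ws) (cong -_ neutral-ab)

      forward : ∀ x y → Cancel a b R₁ R₂ x y → 0ℚ <ℚ weightedW x y ws
      forward x y (R₁∪R₂ , ¬ab) =
        subst (0ℚ <ℚ_) (sym (weightedW-mix x y l m ws₁ ws₂)) (mixture-pos 0<l 0<m (signs R₁∪R₂))
        where
          signs : R₁ x y ⊎ R₂ x y →
                  (0ℚ <ℚ weightedW x y ws₁ × 0ℚ ≤ℚ weightedW x y ws₂)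
                ⊎ (0ℚ ≤ℚ weightedW x y ws₁ × 0ℚ <ℚ weightedW x y ws₂)
          signs (inj₁ R₁xy) = inj₁ (to (maj₁ x y) R₁xy , majority-nonNeg ws₂ maj₂ (conflict-free x y ¬ab R₁xy))
          signs (inj₂ R₂xy) =
            inj₂ (majority-nonNeg ws₁ maj₁ (λ R₁yx → conflict-free y x (λ ab → ¬ab (samePair-swap ab)) R₁yx R₂xy)
                 , to (maj₂ x y) R₂xy)

      backward : ∀ x y → 0ℚ <ℚ weightedW x y ws → Cancel a b R₁ R₂ x y
      backward x y pos = R₁∪R₂ , ¬ab
        where
          ¬ab : ¬ SamePair a b x y
          ¬ab ab = ℚP.<-irrefl refl (subst (0ℚ <ℚ_) (neutral ab) pos)
          R₁∪R₂ : R₁ x y ⊎ R₂ x y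
          R₁∪R₂ with mixture-pos⁻¹ 0<l 0<m (subst (0ℚ <ℚ_) (weightedW-mix x y l m ws₁ ws₂) pos)
          ... | inj₁ pos₁ = inj₁ (from (maj₁ x y) pos₁)
          ... | inj₂ pos₂ = inj₂ (from (maj₂ x y) pos₂)

Next : ℕ → ℕ → ℕ → Set
Next m i j = (i < m × j ≡ suc i) ⊎ (i ≡ m × j ≡ 0)

next-bounded : ∀ {m i j} → Next m i j → i ≤ m × j ≤ m
next-bounded (inj₁ (i<m , refl)) = ℕP.<⇒≤ i<m , i<m
next-bounded (inj₂ (refl , refl)) = ℕP.≤-refl , z≤n

next-irrefl : ∀ {m i} → 1 ≤ m → ¬ Next m i i
next-irrefl _ (inj₁ (_ , i≡1+i)) = ℕP.1+n≢n (sym i≡1+i)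
next-irrefl 1≤m (inj₂ (refl , refl)) = ℕP.<-irrefl refl 1≤m

next-asym : ∀ {m i j} → 2 ≤ m → Next m i j → ¬ Next m j i
next-asym _ (inj₁ (_ , refl)) (inj₁ (_ , i≡2+i)) = ℕP.m≢1+n+m _ {1} i≡2+i
next-asym 2≤m (inj₁ (_ , refl)) (inj₂ (refl , refl)) = ℕP.<-irrefl refl 2≤m
next-asym 2≤m (inj₂ (refl , refl)) (inj₁ (_ , refl)) = ℕP.<-irrefl refl 2≤m
next-asym () (inj₂ (refl , refl)) (inj₂ (refl , refl))

triangle-next : ∀ i j → Tri 0 1 2 i j ⇔ Next 2 i j
triangle-next i j = mk⇔ forward backward
  where
    forward : Tri 0 1 2 i j → Next 2 i j
    forward (inj₁ (refl , refl)) = inj₁ (s≤s z≤n , refl)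
    forward (inj₂ (inj₁ (refl , refl))) = inj₁ (s≤s (s≤s z≤n) , refl)
    forward (inj₂ (inj₂ (refl , refl))) = inj₂ (refl , refl)
    backward : Next 2 i j → Tri 0 1 2 i j
    backward (inj₁ (s≤s z≤n , refl)) = inj₁ (refl , refl)
    backward (inj₁ (s≤s (s≤s z≤n) , refl)) = inj₂ (inj₁ (refl , refl))
    backward (inj₂ (refl , refl)) = inj₂ (inj₂ (refl , refl))

next-split : ∀ {m} → 2 ≤ m → ∀ i j → Next (suc m) i j ⇔ Cancel 0 m (Next m) (Tri 0 m (suc m)) i j
next-split {m} 2≤m i j = mk⇔ forward backward
  where
    forward : Next (suc m) i j → Cancel 0 m (Next m) (Tri 0 m (suc m)) i j
    forward (inj₁ (s≤s i≤m , refl)) with ℕP.m≤n⇒m<n∨m≡n i≤m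
    ... | inj₁ i<m = inj₁ (inj₁ (i<m , refl)) , λ
      { (inj₁ (refl , refl)) → ℕP.<-irrefl refl 2≤m }
    ... | inj₂ refl = inj₂ (inj₂ (inj₁ (refl , refl))) , λ
      { (inj₁ (refl , ())) }
    forward (inj₂ (refl , refl)) = inj₂ (inj₂ (inj₂ (refl , refl))) , λ
      { (inj₂ (refl , m≡1+m)) → ℕP.1+n≢n (sym m≡1+m) }
    backward : Cancel 0 m (Next m) (Tri 0 m (suc m)) i j → Next (suc m) i j
    backward (inj₁ (inj₁ (i<m , refl)) , _) = inj₁ (ℕP.m<n⇒m<1+n i<m , refl)
    backward (inj₁ (inj₂ (refl , refl)) , ¬chord) = ⊥-elim (¬chord (inj₂ (refl , refl)))
    backward (inj₂ (inj₁ (refl , refl)) , ¬chord) = ⊥-elim (¬chord (inj₁ (refl , refl)))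
    backward (inj₂ (inj₂ (inj₁ (refl , refl))) , _) = inj₁ (ℕP.≤-refl , refl)
    backward (inj₂ (inj₂ (inj₂ (refl , refl))) , _) = inj₂ (refl , refl)

next-tri-agree : ∀ {m i j} → ¬ SamePair 0 m i j → Next m i j → ¬ Tri 0 m (suc m) j i
next-tri-agree ¬chord _ (inj₁ (j≡0 , i≡m)) = ¬chord (inj₂ (j≡0 , i≡m))
next-tri-agree _ nxt (inj₂ (inj₁ (_ , refl))) = ℕP.1+n≰n (proj₁ (next-bounded nxt))
next-tri-agree _ nxt (inj₂ (inj₂ (refl , _))) = ℕP.1+n≰n (proj₂ (next-bounded nxt))

tri-bounded : ∀ {m i j} → Tri 0 m (suc m) i j → i ≤ suc m × j ≤ suc m
tri-bounded (inj₁ (refl , refl)) = z≤n , ℕP.n≤1+n _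
tri-bounded (inj₂ (inj₁ (refl , refl))) = ℕP.n≤1+n _ , ℕP.≤-refl
tri-bounded (inj₂ (inj₂ (refl , refl))) = ℕP.≤-refl , z≤n

module Along {n : ℕ} (h : ℕ → Fin n) where

  Image : (ℕ → ℕ → Set) → Rel n
  Image P x y = Σ[ i ∈ ℕ ] Σ[ j ∈ ℕ ] (P i j × h i ≡ x × h j ≡ y)

  Cycle : ℕ → Rel n
  Cycle m = Image (Next m)

  image-⇔ : ∀ {P Q : ℕ → ℕ → Set} → (∀ i j → P i j ⇔ Q i j) → ∀ x y → Image P x y ⇔ Image Q x y
  image-⇔ P⇔Q x y = mk⇔ (λ (i , j , p , hi , hj) → i , j , to (P⇔Q i j) p , hi , hj)
                        (λ (i , j , q , hi , hj) → i , j , from (P⇔Q i j) q , hi , hj)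

  tri-image : ∀ a b c x y → Tri (h a) (h b) (h c) x y ⇔ Image (Tri a b c) x y
  tri-image a b c x y = mk⇔ forward backward
    where
      forward : Tri (h a) (h b) (h c) x y → Image (Tri a b c) x y
      forward (inj₁ (refl , refl)) = a , b , inj₁ (refl , refl) , refl , refl
      forward (inj₂ (inj₁ (refl , refl))) = b , c , inj₂ (inj₁ (refl , refl)) , refl , refl
      forward (inj₂ (inj₂ (refl , refl))) = c , a , inj₂ (inj₂ (refl , refl)) , refl , refl
      backward : Image (Tri a b c) x y → Tri (h a) (h b) (h c) x y
      backward (_ , _ , inj₁ (refl , refl) , refl , refl) = inj₁ (refl , refl)
      backward (_ , _ , inj₂ (inj₁ (refl , refl)) , refl , refl) = inj₂ (inj₁ (refl , refl))
      backward (_ , _ , inj₂ (inj₂ (refl , refl)) , refl , refl) = inj₂ (inj₂ (refl , refl))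

  samePair-image : ∀ {a b i j} → SamePair a b i j → SamePair (h a) (h b) (h i) (h j)
  samePair-image (inj₁ (refl , refl)) = inj₁ (refl , refl)
  samePair-image (inj₂ (refl , refl)) = inj₂ (refl , refl)

  InjectiveUpTo : ℕ → Set
  InjectiveUpTo K = ∀ i j → i ≤ K → j ≤ K → h i ≡ h j → i ≡ j

  module _ {K : ℕ} (inj : InjectiveUpTo K) where

    apart : ∀ {i j} → i ≤ K → j ≤ K → i ≢ j → h i ≢ h j
    apart i≤K j≤K i≢j hi≡hj = i≢j (inj _ _ i≤K j≤K hi≡hj)

    samePair-positions : ∀ {a b i j} → a ≤ K → b ≤ K → i ≤ K → j ≤ K →
      SamePair (h a) (h b) (h i) (h j) → SamePair a b i j
    samePair-positions a≤K b≤K i≤K j≤K (inj₁ (ai , bj)) = inj₁ (inj _ _ a≤K i≤K ai , inj _ _ b≤K j≤K bj)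
    samePair-positions a≤K b≤K i≤K j≤K (inj₂ (aj , bi)) = inj₂ (inj _ _ a≤K j≤K aj , inj _ _ b≤K i≤K bi)

    module _ {m : ℕ} (m≤K : m ≤ K) where

      private
        source≤K : ∀ {i j} → Next m i j → i ≤ K
        source≤K nxt = ℕP.≤-trans (proj₁ (next-bounded nxt)) m≤K
        target≤K : ∀ {i j} → Next m i j → j ≤ K
        target≤K nxt = ℕP.≤-trans (proj₂ (next-bounded nxt)) m≤K

      cycle-irrefl : 1 ≤ m → ∀ {x} → ¬ Cycle m x x
      cycle-irrefl 1≤m (i , j , nxt , hi , hj)
        with refl ← inj i j (source≤K nxt) (target≤K nxt) (trans hi (sym hj)) = next-irrefl 1≤m nxt

      cycle-asym : 2 ≤ m → ∀ {x y} → Cycle m x y → ¬ Cycle m y x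
      cycle-asym 2≤m (i , j , nxt , hi , hj) (j′ , i′ , nxt′ , hj′ , hi′)
        with refl ← inj i i′ (source≤K nxt) (target≤K nxt′) (trans hi (sym hi′))
           | refl ← inj j j′ (target≤K nxt) (source≤K nxt′) (trans hj (sym hj′)) = next-asym 2≤m nxt nxt′

    module _ {m : ℕ} (1+m≤K : suc m ≤ K) where

      private
        m≤K : m ≤ K
        m≤K = ℕP.<⇒≤ 1+m≤K
        ≤K : ∀ {p} → p ≤ suc m → p ≤ K
        ≤K p≤1+m = ℕP.≤-trans p≤1+m 1+m≤K
        off-chord : ∀ {i j} → Next (suc m) i j → ¬ SamePair 0 m i j → ¬ SamePair (h 0) (h m) (h i) (h j)
        off-chord nxt ¬chord same = ¬chord (samePair-positions z≤n m≤K (≤K (proj₁ (next-bounded nxt)))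
                                                                        (≤K (proj₂ (next-bounded nxt))) same)

      cycle-split : 2 ≤ m → ∀ x y →
        Cancel (h 0) (h m) (Cycle m) (Image (Tri 0 m (suc m))) x y ⇔ Cycle (suc m) x y
      cycle-split 2≤m x y = mk⇔ forward backward
        where
          forward : Cancel (h 0) (h m) (Cycle m) (Image (Tri 0 m (suc m))) x y → Cycle (suc m) x y
          forward (inj₁ (i , j , nxt , refl , refl) , ¬chord) =
            i , j , from (next-split 2≤m i j) (inj₁ nxt , λ same → ¬chord (samePair-image same)) , refl , refl
          forward (inj₂ (i , j , tri , refl , refl) , ¬chord) =
            i , j , from (next-split 2≤m i j) (inj₂ tri , λ same → ¬chord (samePair-image same)) , refl , refl
          backward : Cycle (suc m) x y → Cancel (h 0) (h m) (Cycle m) (Image (Tri 0 m (suc m))) x y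
          backward (i , j , nxt , refl , refl) with to (next-split 2≤m i j) nxt
          ... | inj₁ nxt′ , ¬chord = inj₁ (i , j , nxt′ , refl , refl) , off-chord nxt ¬chord
          ... | inj₂ tri , ¬chord = inj₂ (i , j , tri , refl , refl) , off-chord nxt ¬chord

      cycle-tri-agree : ∀ x y → ¬ SamePair (h 0) (h m) x y → Cycle m x y → Image (Tri 0 m (suc m)) y x → ⊥
      cycle-tri-agree x y ¬chord (i , j , nxt , refl , refl) (j′ , i′ , tri , hj′ , hi′)
        with refl ← inj i′ i (≤K (proj₂ (tri-bounded tri))) (≤K (ℕP.m≤n⇒m≤1+n (proj₁ (next-bounded nxt)))) hi′
           | refl ← inj j′ j (≤K (proj₁ (tri-bounded tri))) (≤K (ℕP.m≤n⇒m≤1+n (proj₂ (next-bounded nxt)))) hj′ =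
        next-tri-agree (λ same → ¬chord (samePair-image same)) nxt tri

  module _ (𝒞 : PCF n → Set) {K : ℕ} (inj : InjectiveUpTo K)
           (triangles : ∀ a b c → a ≢ b → b ≢ c → a ≢ c → MajRel 𝒞 (Tri a b c)) where

    triangle-at : ∀ {a b c} → a ≤ K → b ≤ K → c ≤ K → a ≢ b → b ≢ c → a ≢ c →
      MajRel 𝒞 (Image (Tri a b c))
    triangle-at a≤K b≤K c≤K a≢b b≢c a≢c =
      majRel-transport 𝒞 (tri-image _ _ _)
        (triangles _ _ _ (apart inj a≤K b≤K a≢b) (apart inj b≤K c≤K b≢c) (apart inj a≤K c≤K a≢c))

    cycle-majRel : ∀ {m} → 2 ≤ m → m ≤ K → MajRel 𝒞 (Cycle m)
    cycle-majRel {suc m} 2≤1+m 1+m≤K with ℕP.m≤n⇒m<n∨m≡n 2≤1+m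
    ... | inj₂ refl =
      majRel-transport 𝒞 (image-⇔ triangle-next)
        (triangle-at z≤n (ℕP.<⇒≤ 1+m≤K) 1+m≤K (λ ()) (λ ()) (λ ()))
    ... | inj₁ (s≤s 2≤m) =
      majRel-transport 𝒞 (cycle-split inj 1+m≤K 2≤m)
        (cancel 𝒞 (cycle-majRel 2≤m m≤K) (triangle-at z≤n m≤K 1+m≤K 0≢m m≢1+m (λ ()))
           (m , 0 , inj₂ (refl , refl) , refl , refl)
           (0 , m , inj₁ (refl , refl) , refl , refl)
           (cycle-tri-agree inj 1+m≤K))
      where
        m≤K : m ≤ K
        m≤K = ℕP.<⇒≤ 1+m≤K
        0≢m : 0 ≢ m
        0≢m 0≡m = ℕP.<-irrefl 0≡m (ℕP.<-trans (s≤s z≤n) 2≤m)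
        m≢1+m : m ≢ suc m
        m≢1+m m≡1+m = ℕP.1+n≢n (sym m≡1+m)

Step : ∀ {n k} → (Fin k → Fin n) → Rel n
Step f x y = Σ[ i ∈ Fin _ ] (f i ≡ x × f (next i) ≡ y)

module _ {n k : ℕ} (f : Fin k → Fin n) where

  cyc-forward : ∀ {x y} → Step f x y → cyc f x y ≡ just x
  cyc-forward {x} {y} xy with Step? f x y
  ... | yes _ = refl
  ... | no ¬xy = ⊥-elim (¬xy xy)

  cyc-backward : ∀ {x y} → ¬ Step f x y → Step f y x → cyc f x y ≡ just y
  cyc-backward {x} {y} ¬xy yx with Step? f x y
  ... | yes xy = ⊥-elim (¬xy xy)
  ... | no _ with Step? f y x
  ...   | yes _ = refl
  ...   | no ¬yx = ⊥-elim (¬yx yx)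

  cyc-none : ∀ {x y} → ¬ Step f x y → ¬ Step f y x → cyc f x y ≡ nothing
  cyc-none {x} {y} ¬xy ¬yx with Step? f x y
  ... | yes xy = ⊥-elim (¬xy xy)
  ... | no _ with Step? f y x
  ...   | yes yx = ⊥-elim (¬yx yx)
  ...   | no _ = refl

  module _ (step-irrefl : ∀ {x} → ¬ Step f x x) where

    cyc-decides : ∀ x y → Step f x y ⇔ (cyc f x y ≡ just x)
    cyc-decides x y = mk⇔ cyc-forward (by-cases (Step? f x y) (Step? f y x))
      where
        by-cases : Dec (Step f x y) → Dec (Step f y x) → cyc f x y ≡ just x → Step f x y
        by-cases (yes xy) _ _ = xy
        by-cases (no ¬xy) (yes yx) cyc≡x =
          ⊥-elim (step-irrefl (subst (λ z → Step f z x) (just-injective (trans (sym (cyc-backward ¬xy yx)) cyc≡x)) yx))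
        by-cases (no ¬xy) (no ¬yx) cyc≡x with () ← trans (sym (cyc-none ¬xy ¬yx)) cyc≡x

    cyc-isPCF : (∀ {x y} → Step f x y → ¬ Step f y x) → IsPCF (cyc f)
    cyc-isPCF step-asym = record
      { symm = λ x y → symm (Step? f x y) (Step? f y x)
      ; irrefl = λ x → irrefl (Step? f x x)
      ; valid = λ x y z → valid (Step? f x y) (Step? f y x) }
      where
        symm : ∀ {x y} → Dec (Step f x y) → Dec (Step f y x) → cyc f x y ≡ cyc f y x
        symm (yes xy) (yes yx) = ⊥-elim (step-asym xy yx)
        symm (yes xy) (no ¬yx) = trans (cyc-forward xy) (sym (cyc-backward ¬yx xy))
        symm (no ¬xy) (yes yx) = trans (cyc-backward ¬xy yx) (sym (cyc-forward yx))
        symm (no ¬xy) (no ¬yx) = trans (cyc-none ¬xy ¬yx) (sym (cyc-none ¬yx ¬xy))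
        irrefl : ∀ {x} → Dec (Step f x x) → cyc f x x ≡ nothing
        irrefl (yes xx) = ⊥-elim (step-irrefl xx)
        irrefl (no ¬xx) = cyc-none ¬xx ¬xx
        valid : ∀ {x y z} → Dec (Step f x y) → Dec (Step f y x) → cyc f x y ≡ just z → z ≡ x ⊎ z ≡ y
        valid (yes xy) _ dxy = inj₁ (just-injective (trans (sym dxy) (cyc-forward xy)))
        valid (no ¬xy) (yes yx) dxy = inj₂ (just-injective (trans (sym dxy) (cyc-backward ¬xy yx)))
        valid (no ¬xy) (no ¬yx) dxy with () ← trans (sym dxy) (cyc-none ¬xy ¬yx)

triangle-step : ∀ {n} (x y z a b : Fin n) → Step (lookup (x ∷ y ∷ z ∷ [])) a b ⇔ Tri x y z a b
triangle-step x y z a b = mk⇔ forward backward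
  where
    forward : Step (lookup (x ∷ y ∷ z ∷ [])) a b → Tri x y z a b
    forward (Fin.zero , xa , yb) = inj₁ (xa , yb)
    forward (Fin.suc Fin.zero , ya , zb) = inj₂ (inj₁ (ya , zb))
    forward (Fin.suc (Fin.suc Fin.zero) , za , xb) = inj₂ (inj₂ (za , xb))
    backward : Tri x y z a b → Step (lookup (x ∷ y ∷ z ∷ [])) a b
    backward (inj₁ (xa , yb)) = Fin.zero , xa , yb
    backward (inj₂ (inj₁ (ya , zb))) = Fin.suc Fin.zero , ya , zb
    backward (inj₂ (inj₂ (za , xb))) = Fin.suc (Fin.suc Fin.zero) , za , xb

triangle-irrefl : ∀ {n} {x y z a : Fin n} → x ≢ y → y ≢ z → x ≢ z → ¬ Tri x y z a a
triangle-irrefl x≢y _ _ (inj₁ (refl , y≡x)) = x≢y (sym y≡x)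
triangle-irrefl _ y≢z _ (inj₂ (inj₁ (refl , z≡y))) = y≢z (sym z≡y)
triangle-irrefl _ _ x≢z (inj₂ (inj₂ (refl , x≡z))) = x≢z x≡z

module Periodic {n m : ℕ} (f : Fin (suc m) → Fin n) (f-inj : Injective _≡_ _≡_ f) where

  position : ℕ → Fin (suc m)
  position j = fromℕ< (m%n<n j (suc m))

  g : ℕ → Fin n
  g j = f (position j)

  open Along g using (Cycle; InjectiveUpTo)

  toℕ-position : ∀ {j} → j ≤ m → toℕ (position j) ≡ j
  toℕ-position j≤m = trans (FinP.toℕ-fromℕ< _) (m<n⇒m%n≡m (s≤s j≤m))

  g-inj : InjectiveUpTo m
  g-inj i j i≤m j≤m gi≡gj = begin
    i                     ≡⟨ sym (toℕ-position i≤m) ⟩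
    toℕ (position i)      ≡⟨ cong toℕ (f-inj gi≡gj) ⟩
    toℕ (position j)      ≡⟨ toℕ-position j≤m ⟩
    j                     ∎
    where open ≡-Reasoning

  position-toℕ : ∀ p → position (toℕ p) ≡ p
  position-toℕ p = FinP.toℕ-injective (toℕ-position (ℕP.≤-pred (FinP.toℕ<n p)))

  g-wrap : g (suc m) ≡ g 0
  g-wrap = cong f (FinP.fromℕ<-cong (suc m % suc m) 0 (n%n≡0 (suc m)) (m%n<n (suc m) (suc m)) (m%n<n 0 (suc m)))

  -- The edges of f are those of the cycle along g; note that f (next p)
  -- is g (suc (toℕ p)) by the definition of next.
  cycle⇔step : ∀ x y → Cycle m x y ⇔ Step f x y
  cycle⇔step x y = mk⇔ forward backward
    where
      forward : Cycle m x y → Step f x y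
      forward (i , _ , inj₁ (i<m , refl) , gi≡x , gj≡y) =
        position i , gi≡x , trans (cong (λ t → g (suc t)) (toℕ-position (ℕP.<⇒≤ i<m))) gj≡y
      forward (_ , _ , inj₂ (refl , refl) , gm≡x , g0≡y) =
        position m , gm≡x , trans (cong (λ t → g (suc t)) (toℕ-position ℕP.≤-refl)) (trans g-wrap g0≡y)
      backward : Step f x y → Cycle m x y
      backward (p , fp≡x , fnext≡y) with ℕP.m≤n⇒m<n∨m≡n (ℕP.≤-pred (FinP.toℕ<n p))
      ... | inj₁ i<m = toℕ p , suc (toℕ p) , inj₁ (i<m , refl) , trans (cong f (position-toℕ p)) fp≡x , fnext≡y
      ... | inj₂ i≡m = toℕ p , 0 , inj₂ (i≡m , refl) , trans (cong f (position-toℕ p)) fp≡x ,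
                       trans (sym g-wrap) (trans (cong (λ t → g (suc t)) (sym i≡m)) fnext≡y)

  module _ (2≤m : 2 ≤ m) where

    step-irrefl : ∀ {x} → ¬ Step f x x
    step-irrefl xx = Along.cycle-irrefl g g-inj ℕP.≤-refl (ℕP.<⇒≤ 2≤m) (from (cycle⇔step _ _) xx)

    step-asym : ∀ {x y} → Step f x y → ¬ Step f y x
    step-asym xy yx = Along.cycle-asym g g-inj ℕP.≤-refl 2≤m (from (cycle⇔step _ _) xy) (from (cycle⇔step _ _) yx)

    cyc-inMaj : (𝒞 : PCF n → Set) → (∀ a b c → a ≢ b → b ≢ c → a ≢ c → MajRel 𝒞 (Tri a b c)) →
      InMaj 𝒞 (cyc f)
    cyc-inMaj 𝒞 triangles =
      cyc-isPCF f step-irrefl step-asym ,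
      majRel-transport 𝒞 (λ x y → cyc-decides f step-irrefl x y ⇔-∘ cycle⇔step x y)
        (Along.cycle-majRel g 𝒞 g-inj triangles 2≤m ℕP.≤-refl)

triangles-majRel : ∀ {n} (𝒞 : PCF n → Set) →
  (∀ (x y z : Fin n) → x ≢ y → y ≢ z → x ≢ z → InMaj 𝒞 (cyc (lookup (x ∷ y ∷ z ∷ [])))) →
  ∀ x y z → x ≢ y → y ≢ z → x ≢ z → MajRel 𝒞 (Tri x y z)
triangles-majRel {n} 𝒞 triangles x y z x≢y y≢z x≢z =
  majRel-transport 𝒞 (λ a b → triangle-step x y z a b ⇔-∘ ⇔-sym (cyc-decides v v-irrefl a b))
    (proj₂ (triangles x y z x≢y y≢z x≢z))
  where
    v : Fin 3 → Fin n
    v = lookup (x ∷ y ∷ z ∷ [])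
    v-irrefl : ∀ {a} → ¬ Step v a a
    v-irrefl aa = triangle-irrefl x≢y y≢z x≢z (to (triangle-step x y z _ _) aa)

mainTheorem6 : (n : ℕ) → 3 ≤ n → (𝒞 : PCF n → Set) →
    (∀ (x y z : Fin n) → x ≢ y → y ≢ z → x ≢ z →
       InMaj 𝒞 (cyc (lookup (x ∷ y ∷ z ∷ [])))) →
    (k : ℕ) → 3 ≤ k → (f : Fin k → Fin n) → Injective _≡_ _≡_ f →
    InMaj 𝒞 (cyc f)
mainTheorem6 n _ 𝒞 triangles (suc m) (s≤s 2≤m) f f-inj =
  Periodic.cyc-inMaj f f-inj 2≤m 𝒞 (triangles-majRel 𝒞 triangles)
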